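{- If $P$ is a $0$-$1$ matrix with $ex(n,P) = O(n)$, then $sm(m,P) = O(m^{1/2})$.
   Context: A $0$-$1$ matrix $A$ contains a $0$-$1$ matrix $P$ if some submatrix of $A$ (obtained by selecting a subset of rows and a subset of columns, preserving order) either equals $P$ or can be changed into $P$ by turning some ones into zeroes; otherwise $A$ avoids $P$. For $0$-$1$ matrices $A, P$, $LSM(A,P)$ is the maximum number of ones in a $P$-avoiding $0$-$1$ matrix $B$ that is contained in $A$. $sm(m,P)$ is the minimum of $LSM(A,P)$ over all $0$-$1$ matrices $A$ with exactly $m$ ones. $ex(n,P)$ is the maximum number of ones in an $n\times n$ $0$-$1$ matrix that avoids $P$. -}

module Defs where

open import Data.Nat using (ℕ; zero; suc; _+_; _≤_)
open import Data.Bool using (Bool; true; false)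
open import Data.Fin using (Fin; _<_)
import Data.Fin as F
open import Data.Product using (Σ; ∃; _×_)
open import Relation.Binary.PropositionalEquality using (_≡_)
open import Relation.Nullary using (¬_)

Mat : ℕ → ℕ → Set
Mat r s = Fin r → Fin s → Bool

StrictMono : ∀ {k r} → (Fin k → Fin r) → Set
StrictMono {k} f = ∀ (i j : Fin k) → i < j → f i < f j

-- A contains P: some submatrix of A (rows f, columns g, order preserved)
-- has a one wherever P has a one (i.e. equals P after turning some ones to zeros).
Contains : ∀ {r s k l} → Mat r s → Mat k l → Set
Contains {r} {s} {k} {l} A P =
  Σ (Fin k → Fin r) λ f → Σ (Fin l → Fin s) λ g →
    StrictMono f × StrictMono g ×
    (∀ (i : Fin k) (j : Fin l) → P i j ≡ true → A (f i) (g j) ≡ true)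

Avoids : ∀ {r s k l} → Mat r s → Mat k l → Set
Avoids A P = ¬ Contains A P

countRow : ∀ {s} → (Fin s → Bool) → ℕ
countRow {zero} v = 0
countRow {suc s} v with v F.zero
... | true  = suc (countRow (λ j → v (F.suc j)))
... | false = countRow (λ j → v (F.suc j))

ones : ∀ {r s} → Mat r s → ℕ
ones {zero} A = 0
ones {suc r} A = countRow (A F.zero) + ones (λ i → A (F.suc i))

-- ex(n,P) ≤ b : every n × n P-avoiding matrix has at most b ones.
ExAtMost : ∀ {k l} → ℕ → Mat k l → ℕ → Set
ExAtMost n P b = ∀ (M : Mat n n) → Avoids M P → ones M ≤ b

-- LSM(A,P) ≤ b : every P-avoiding matrix B contained in A has at most b ones.
LSMAtMost : ∀ {r s k l} → Mat r s → Mat k l → ℕ → Set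
LSMAtMost A P b =
  ∀ (r' s' : ℕ) (B : Mat r' s') → Contains A B → Avoids B P → ones B ≤ b

-- sm(m,P) ≤ b : some 0-1 matrix A (of any dimensions) with exactly m ones
-- has LSM(A,P) ≤ b.
SmAtMost : ∀ {k l} → ℕ → Mat k l → ℕ → Set
SmAtMost m P b = ∃ λ r → ∃ λ s → Σ (Mat r s) λ A → ones A ≡ m × LSMAtMost A P b

-- Let ex(n,P) ≤ c n for n ≥ N. For m ≥ N², pick n with m ≤ n² ≤ 4m and let A be any n × n
-- matrix with exactly m ones. A matrix B contained in A is at most n × n. Erasing the last k
-- rows and the last l columns of B costs at most (k + l) n ones, and what is left, padded with
-- zeros to n × n, still avoids P: an occurrence of P in it can be pushed back into B, since a
-- row (column) of the occurrence that meets no one of P may be moved into the erased strip.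
-- Hence LSM(A,P) ≤ (c + k + l) n = O(√m).
module Submission where

open import Defs
open import Data.Nat using (ℕ; zero; suc; _+_; _*_; _∸_; _⊓_; _≤_; _<_; _<ᵇ_; z≤n; s≤s; _≤?_)
open import Data.Nat.Properties
open import Data.Nat.Tactic.RingSolver using (solve-∀)
open import Algebra.Properties.CommutativeSemigroup +-commutativeSemigroup
  using () renaming (interchange to +-interchange)
open import Algebra.Properties.CommutativeSemigroup *-commutativeSemigroup
  using () renaming (interchange to *-interchange)
open import Data.Bool using (Bool; true; false; _∧_; T)
open import Data.Fin using (Fin; toℕ; fromℕ<; splitAt; _↑ˡ_)
import Data.Fin as F
open import Data.Fin.Properties
  using (toℕ-injective; toℕ-fromℕ<; toℕ<n; toℕ-↑ˡ; splitAt⁻¹-↑ˡ; injective⇒≤)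
open import Data.Vec.Functional using (_++_)
open import Data.Sum using (inj₁; inj₂)
open import Data.Sum.Properties using ([,]-map)
open import Data.Product using (∃; ∃₂; _×_; _,_)
open import Function using (_∘_)
open import Function.Definitions using (Injective)
open import Relation.Binary using (tri<; tri≈; tri>)
open import Relation.Binary.PropositionalEquality
open import Relation.Nullary using (yes; no; contradiction)

++-suc : ∀ {a m n} {A : Set a} (xs : Fin (suc m) → A) (ys : Fin n → A) →
         (xs ++ ys) ∘ F.suc ≗ (xs ∘ F.suc) ++ ys
++-suc {m = m} xs ys = [,]-map ∘ splitAt m

countRow-cong : ∀ {s} {u v : Fin s → Bool} → u ≗ v → countRow u ≡ countRow v
countRow-cong {zero} e = refl
countRow-cong {suc s} {u} {v} e with u F.zero | v F.zero | e F.zero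
... | true  | .true  | refl = cong suc (countRow-cong (e ∘ F.suc))
... | false | .false | refl = countRow-cong (e ∘ F.suc)

countRow≤ : ∀ {s} (v : Fin s → Bool) → countRow v ≤ s
countRow≤ {zero} v = z≤n
countRow≤ {suc s} v with v F.zero
... | true  = s≤s (countRow≤ (v ∘ F.suc))
... | false = m≤n⇒m≤1+n (countRow≤ (v ∘ F.suc))

countRow-false : ∀ {s} → countRow {s} (λ _ → false) ≡ 0
countRow-false {zero} = refl
countRow-false {suc s} = countRow-false {s}

countRow-++ : ∀ {s t} (u : Fin s → Bool) (v : Fin t → Bool) →
              countRow (u ++ v) ≡ countRow u + countRow v
countRow-++ {zero} u v = refl
countRow-++ {suc s} u v with u F.zero
... | true  = cong suc (trans (countRow-cong (++-suc u v)) (countRow-++ (u ∘ F.suc) v))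
... | false = trans (countRow-cong (++-suc u v)) (countRow-++ (u ∘ F.suc) v)

countRow-prefix : ∀ s t → countRow {s} (λ j → toℕ j <ᵇ t) ≡ t ⊓ s
countRow-prefix zero    zero    = refl
countRow-prefix zero    (suc t) = refl
countRow-prefix (suc s) zero    = countRow-false {s}
countRow-prefix (suc s) (suc t) = cong suc (countRow-prefix s t)

countRow-maskPrefix : ∀ {s} (v : Fin s → Bool) t →
                      countRow v ≤ countRow (λ j → (toℕ j <ᵇ t) ∧ v j) + (s ∸ t)
countRow-maskPrefix {zero}  v t = z≤n
countRow-maskPrefix {suc s} v zero =
  ≤-trans (countRow≤ v) (m≤n+m (suc s) (countRow {suc s} (λ _ → false)))
countRow-maskPrefix {suc s} v (suc t) with v F.zero
... | true  = s≤s (countRow-maskPrefix (v ∘ F.suc) t)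
... | false = countRow-maskPrefix (v ∘ F.suc) t

ones-cong-countRow : ∀ {r s t} {A : Mat r s} {B : Mat r t} →
                     (∀ i → countRow (A i) ≡ countRow (B i)) → ones A ≡ ones B
ones-cong-countRow {zero}  e = refl
ones-cong-countRow {suc r} e = cong₂ _+_ (e F.zero) (ones-cong-countRow (e ∘ F.suc))

ones-mono-countRow : ∀ {r s t} {A : Mat r s} {B : Mat r t} d →
                     (∀ i → countRow (A i) ≤ countRow (B i) + d) → ones A ≤ ones B + r * d
ones-mono-countRow {zero}  d le = z≤n
ones-mono-countRow {suc r} {A = A} {B} d le = begin
  countRow (A F.zero) + ones (A ∘ F.suc)
    ≤⟨ +-mono-≤ (le F.zero) (ones-mono-countRow d (le ∘ F.suc)) ⟩
  (countRow (B F.zero) + d) + (ones (B ∘ F.suc) + r * d)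
    ≡⟨ +-interchange (countRow (B F.zero)) d (ones (B ∘ F.suc)) (r * d) ⟩
  ones B + suc r * d ∎
  where open ≤-Reasoning

ones≤ : ∀ {r s} (A : Mat r s) → ones A ≤ r * s
ones≤ {zero}  A = z≤n
ones≤ {suc r} A = +-mono-≤ (countRow≤ (A F.zero)) (ones≤ (A ∘ F.suc))

ones-false : ∀ {r s} → ones {r} {s} (λ _ _ → false) ≡ 0
ones-false {zero}      = refl
ones-false {suc r} {s} = cong₂ _+_ (countRow-false {s}) (ones-false {r})

ones-++ : ∀ {r a s} (A : Mat r s) (B : Mat a s) → ones (A ++ B) ≡ ones A + ones B
ones-++ {zero}  A B = refl
ones-++ {suc r} A B = trans
  (cong (countRow (A F.zero) +_) (trans (ones-cong-countRow (cong countRow ∘ ++-suc A B))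
                                        (ones-++ (A ∘ F.suc) B)))
  (sym (+-assoc (countRow (A F.zero)) _ _))

ones-maskCols : ∀ {r s} (A : Mat r s) t →
                ones A ≤ ones (λ i j → (toℕ j <ᵇ t) ∧ A i j) + r * (s ∸ t)
ones-maskCols A t = ones-mono-countRow _ (λ i → countRow-maskPrefix (A i) t)

ones-maskRows : ∀ {r s} (A : Mat r s) t →
                ones A ≤ ones (λ i j → (toℕ i <ᵇ t) ∧ A i j) + (r ∸ t) * s
ones-maskRows {zero}      A t       = z≤n
ones-maskRows {suc r} {s} A zero    =
  ≤-trans (ones≤ A) (m≤n+m (suc r * s) (ones {suc r} {s} (λ _ _ → false)))
ones-maskRows {suc r} {s} A (suc t) = ≤-trans
  (+-monoʳ-≤ (countRow (A F.zero)) (ones-maskRows (A ∘ F.suc) t))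
  (≤-reflexive (sym (+-assoc (countRow (A F.zero)) _ _)))

pad : ∀ {r s} a b → Mat r s → Mat (r + a) (s + b)
pad a b B = (λ i → B i ++ (λ _ → false)) ++ (λ _ _ → false)

ones-pad : ∀ {r s} a b (B : Mat r s) → ones (pad a b B) ≡ ones B
ones-pad {r} {s} a b B = begin
  ones (pad a b B)
    ≡⟨ ones-++ {r} {a} padded-rows (λ _ _ → false) ⟩
  ones padded-rows + ones {a} {s + b} (λ _ _ → false)
    ≡⟨ cong₂ _+_ (ones-cong-countRow countRow-padded-row) (ones-false {a}) ⟩
  ones B + 0
    ≡⟨ +-identityʳ (ones B) ⟩
  ones B ∎
  where
  open ≡-Reasoning
  padded-rows : Mat r (s + b)
  padded-rows i = B i ++ (λ _ → false)

  countRow-padded-row : ∀ i → countRow (padded-rows i) ≡ countRow (B i)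
  countRow-padded-row i = begin
    countRow (B i ++ (λ _ → false))               ≡⟨ countRow-++ (B i) (λ _ → false) ⟩
    countRow (B i) + countRow {b} (λ _ → false)   ≡⟨ cong (countRow (B i) +_) (countRow-false {b}) ⟩
    countRow (B i) + 0                            ≡⟨ +-identityʳ _ ⟩
    countRow (B i)                                ∎

pad-true : ∀ {r s} a b (B : Mat r s) x y → pad a b B x y ≡ true →
           ∃₂ λ i j → i ↑ˡ a ≡ x × j ↑ˡ b ≡ y × B i j ≡ true
pad-true {r} {s} a b B x y e with splitAt r x in x≡i
... | inj₂ _ = contradiction e λ ()
... | inj₁ i with splitAt s y in y≡j
...   | inj₂ _ = contradiction e λ ()
...   | inj₁ j = i , j , splitAt⁻¹-↑ˡ x≡i , splitAt⁻¹-↑ˡ y≡j , e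

StrictMono⇒≤ : ∀ {k r} {f : Fin k → Fin r} → StrictMono f → k ≤ r
StrictMono⇒≤ {f = f} f-mono = injective⇒≤ f-injective
  where
  f-injective : Injective _≡_ _≡_ f
  f-injective {i} {j} fi≡fj with <-cmp (toℕ i) (toℕ j)
  ... | tri< i<j _ _ = contradiction (cong toℕ fi≡fj) (<⇒≢ (f-mono i j i<j))
  ... | tri≈ _ i≡j _ = toℕ-injective i≡j
  ... | tri> _ _ j<i = contradiction (cong toℕ (sym fi≡fj)) (<⇒≢ (f-mono j i j<i))

-- r ∸ k + i is strictly increasing in i and below r, so taking the minimum with it keeps a
-- strictly increasing f strictly increasing and fixes its values below r ∸ k.
clip : ∀ {k r n} → k ≤ r → (Fin k → Fin n) → Fin k → Fin r
clip {k} {r} k≤r f i = fromℕ< (≤-<-trans (m⊓n≤n (toℕ (f i)) (r ∸ k + toℕ i)) slot<r)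
  where
  slot<r : r ∸ k + toℕ i < r
  slot<r = ≤-trans (+-monoʳ-< (r ∸ k) (toℕ<n i)) (≤-reflexive (m∸n+n≡m k≤r))

toℕ-clip : ∀ {k r n} (k≤r : k ≤ r) (f : Fin k → Fin n) i →
           toℕ (clip k≤r f i) ≡ toℕ (f i) ⊓ (r ∸ k + toℕ i)
toℕ-clip k≤r f i = toℕ-fromℕ< _

clip-mono : ∀ {k r n} (k≤r : k ≤ r) {f : Fin k → Fin n} → StrictMono f → StrictMono (clip k≤r f)
clip-mono {k} {r} k≤r {f} f-mono i j i<j
  rewrite toℕ-clip k≤r f i | toℕ-clip k≤r f j = ⊓-mono-< (f-mono i j i<j) (+-monoʳ-< (r ∸ k) i<j)

clip-fixes : ∀ {k r n} (k≤r : k ≤ r) (f : Fin k → Fin n) i →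
             toℕ (f i) < r ∸ k → toℕ (clip k≤r f i) ≡ toℕ (f i)
clip-fixes {k} {r} k≤r f i fi<r∸k =
  trans (toℕ-clip k≤r f i) (m≤n⇒m⊓n≡m (≤-trans (<⇒≤ fi<r∸k) (m≤m+n (r ∸ k) (toℕ i))))

window : ∀ {r s} → ℕ → ℕ → Mat r s → Mat r s
window p q B i j = (toℕ i <ᵇ p) ∧ (toℕ j <ᵇ q) ∧ B i j

window-true : ∀ {r s p q} (B : Mat r s) i j → window p q B i j ≡ true →
              toℕ i < p × toℕ j < q × B i j ≡ true
window-true {p = p} {q} B i j e with toℕ i <ᵇ p in i<p | toℕ j <ᵇ q in j<q
... | false | _     = contradiction e λ ()
... | true  | false = contradiction e λ ()
... | true  | true  = <ᵇ⇒< _ _ (subst T (sym i<p) _) , <ᵇ⇒< _ _ (subst T (sym j<q) _) , e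

ones-window : ∀ {r s} (B : Mat r s) p q →
              ones B ≤ ones (window p q B) + (r ∸ p) * s + r * (s ∸ q)
ones-window B p q =
  ≤-trans (ones-maskCols B q) (+-monoˡ-≤ _ (ones-maskRows (λ i j → (toℕ j <ᵇ q) ∧ B i j) p))

Avoids-pad-window : ∀ {r s k l} a b {B : Mat r s} {P : Mat k l} (k≤r : k ≤ r) (l≤s : l ≤ s) →
                    Avoids B P → Avoids (pad a b (window (r ∸ k) (s ∸ l) B)) P
Avoids-pad-window a b {B} {P} k≤r l≤s B-avoids (f , g , f-mono , g-mono , P⊆) =
  B-avoids (clip k≤r f , clip l≤s g , clip-mono k≤r f-mono , clip-mono l≤s g-mono , P⊆B)
  where
  clip-back : ∀ {k r a} (k≤r : k ≤ r) (f : Fin k → Fin (r + a)) i i' →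
              i' ↑ˡ a ≡ f i → toℕ i' < r ∸ k → clip k≤r f i ≡ i'
  clip-back {k} {r} {a} k≤r f i i' i'≡fi i'<r∸k = toℕ-injective (begin
    toℕ (clip k≤r f i) ≡⟨ clip-fixes k≤r f i (subst (_< r ∸ k) (sym fi≡i') i'<r∸k) ⟩
    toℕ (f i)          ≡⟨ fi≡i' ⟩
    toℕ i'             ∎)
    where
    open ≡-Reasoning
    fi≡i' : toℕ (f i) ≡ toℕ i'
    fi≡i' = trans (cong toℕ (sym i'≡fi)) (toℕ-↑ˡ i' a)

  P⊆B : ∀ i j → P i j ≡ true → B (clip k≤r f i) (clip l≤s g j) ≡ true
  P⊆B i j Pij with pad-true a b _ (f i) (g j) (P⊆ i j Pij)
  ... | i' , j' , i'≡fi , j'≡gj , W with window-true B i' j' W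
  ... | i'<r∸k , j'<s∸l , B≡true =
    subst₂ (λ x y → B x y ≡ true) (sym (clip-back k≤r f i i' i'≡fi i'<r∸k))
                                  (sym (clip-back l≤s g j j' j'≡gj j'<s∸l)) B≡true

ExAtMost-≡ : ∀ {n k l b} {P : Mat k l} → ExAtMost n P b →
             ∀ {r s} (M : Mat r s) → r ≡ n → s ≡ n → Avoids M P → ones M ≤ b
ExAtMost-≡ ex M refl refl = ex M

Avoids⇒ones≤ : ∀ {n k l b r s} {P : Mat k l} → ExAtMost n P b → r ≤ n → s ≤ n →
                 (B : Mat r s) → Avoids B P → ones B ≤ b + (k + l) * n
Avoids⇒ones≤ {n} {k} {l} {b} {r} {s} ex r≤n s≤n B B-avoids with k ≤? r | l ≤? s
... | no k≰r | _ = ≤-trans (ones≤ B) (begin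
  r * s               ≤⟨ *-mono-≤ (<⇒≤ (≰⇒> k≰r)) s≤n ⟩
  k * n               ≤⟨ *-monoˡ-≤ n (m≤m+n k l) ⟩
  (k + l) * n         ≤⟨ m≤n+m _ b ⟩
  b + (k + l) * n     ∎)
  where open ≤-Reasoning
... | yes _ | no l≰s = ≤-trans (ones≤ B) (begin
  r * s               ≤⟨ *-mono-≤ r≤n (<⇒≤ (≰⇒> l≰s)) ⟩
  n * l               ≡⟨ *-comm n l ⟩
  l * n               ≤⟨ *-monoˡ-≤ n (m≤n+m l k) ⟩
  (k + l) * n         ≤⟨ m≤n+m _ b ⟩
  b + (k + l) * n     ∎)
  where open ≤-Reasoning
... | yes k≤r | yes l≤s = begin
  ones B                                             ≤⟨ ones-window B (r ∸ k) (s ∸ l) ⟩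
  ones W + (r ∸ (r ∸ k)) * s + r * (s ∸ (s ∸ l))   ≡⟨ cong₂ (λ x y → ones W + x * s + r * y)
                                                              (m∸[m∸n]≡n k≤r) (m∸[m∸n]≡n l≤s) ⟩
  ones W + k * s + r * l                             ≤⟨ +-mono-≤ (+-mono-≤ W-bound (*-monoʳ-≤ k s≤n))
                                                                 (*-monoˡ-≤ l r≤n) ⟩
  b + k * n + n * l                                  ≡⟨ collect b k l n ⟩
  b + (k + l) * n                                    ∎
  where
  open ≤-Reasoning
  W : Mat r s
  W = window (r ∸ k) (s ∸ l) B

  W-bound : ones W ≤ b
  W-bound = subst (_≤ b) (ones-pad (n ∸ r) (n ∸ s) W)
    (ExAtMost-≡ ex (pad (n ∸ r) (n ∸ s) W) (m+[n∸m]≡n r≤n) (m+[n∸m]≡n s≤n)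
                (Avoids-pad-window (n ∸ r) (n ∸ s) k≤r l≤s B-avoids))

  collect : ∀ b k l n → b + k * n + n * l ≡ b + (k + l) * n
  collect = solve-∀

LSMAtMost-square : ∀ {n k l b} {P : Mat k l} → ExAtMost n P b →
                   (A : Mat n n) → LSMAtMost A P (b + (k + l) * n)
LSMAtMost-square ex A r s B (f , g , f-mono , g-mono , _) =
  Avoids⇒ones≤ ex (StrictMono⇒≤ f-mono) (StrictMono⇒≤ g-mono) B

fillRowMajor : ∀ r s → ℕ → Mat r s
fillRowMajor (suc r) s m F.zero    j = toℕ j <ᵇ m
fillRowMajor (suc r) s m (F.suc i)   = fillRowMajor r s (m ∸ s) i

ones-fillRowMajor : ∀ r s m → m ≤ r * s → ones (fillRowMajor r s m) ≡ m
ones-fillRowMajor zero    s .zero z≤n = refl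
ones-fillRowMajor (suc r) s m m≤rs with m ≤? s
... | yes m≤s = begin
  countRow {s} (λ j → toℕ j <ᵇ m) + ones (fillRowMajor r s (m ∸ s))
    ≡⟨ cong₂ _+_ (trans (countRow-prefix s m) (m≤n⇒m⊓n≡m m≤s))
                 (trans (cong (ones ∘ fillRowMajor r s) (m≤n⇒m∸n≡0 m≤s))
                        (ones-fillRowMajor r s 0 z≤n)) ⟩
  m + 0
    ≡⟨ +-identityʳ m ⟩
  m ∎
  where open ≡-Reasoning
... | no m≰s = begin
  countRow {s} (λ j → toℕ j <ᵇ m) + ones (fillRowMajor r s (m ∸ s))
    ≡⟨ cong₂ _+_ (trans (countRow-prefix s m) (m≥n⇒m⊓n≡n s≤m))
                 (ones-fillRowMajor r s (m ∸ s)
                    (subst (m ∸ s ≤_) (m+n∸m≡n s (r * s)) (∸-monoˡ-≤ s m≤rs))) ⟩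
  s + (m ∸ s)
    ≡⟨ m+[n∸m]≡n s≤m ⟩
  m ∎
  where
  open ≡-Reasoning
  s≤m : s ≤ m
  s≤m = <⇒≤ (≰⇒> m≰s)

SmAtMost-square : ∀ {n k l b m} {P : Mat k l} → ExAtMost n P b → m ≤ n * n →
                  SmAtMost m P (b + (k + l) * n)
SmAtMost-square {n} {m = m} ex m≤n² =
  n , n , fillRowMajor n n m , ones-fillRowMajor n n m m≤n² ,
  LSMAtMost-square ex (fillRowMajor n n m)

suc-square≤ : ∀ n → suc n * suc n ≤ 4 * suc (n * n)
suc-square≤ n = begin
  suc n * suc n                                ≡⟨ expand n ⟩
  1 + (n + n) + n * n                          ≤⟨ +-monoˡ-≤ (n * n) (+-monoʳ-≤ 1 (+-mono-≤ n≤n² n≤n²)) ⟩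
  1 + (n * n + n * n) + n * n                  ≤⟨ m≤m+n _ (3 + n * n) ⟩
  1 + (n * n + n * n) + n * n + (3 + n * n)    ≡⟨ regroup n ⟩
  4 * suc (n * n)                              ∎
  where
  open ≤-Reasoning
  self≤square : ∀ x → x ≤ x * x
  self≤square zero        = z≤n
  self≤square x@(suc _)   = m≤m*n x x
  n≤n² : n ≤ n * n
  n≤n² = self≤square n
  expand : ∀ n → suc n * suc n ≡ 1 + (n + n) + n * n
  expand = solve-∀
  regroup : ∀ n → 1 + (n * n + n * n) + n * n + (3 + n * n) ≡ 4 * suc (n * n)
  regroup = solve-∀

square-between : ∀ m → ∃ λ n → m ≤ n * n × n * n ≤ 4 * m
square-between zero = 0 , z≤n , z≤n
square-between (suc m) with square-between m
... | n , m≤n² , n²≤4m with suc m ≤? n * n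
...   | yes m<n² = n , m<n² , ≤-trans n²≤4m (*-monoʳ-≤ 4 (n≤1+n m))
...   | no m≮n²  = suc n , subst (λ x → suc x ≤ suc n * suc n) n²≡m (*-mono-< (n<1+n n) (n<1+n n))
                         , subst (λ x → suc n * suc n ≤ 4 * suc x) n²≡m (suc-square≤ n)
  where
  n²≡m : n * n ≡ m
  n²≡m = ≤-antisym (≮⇒≥ m≮n²) m≤n²

square-reflects-≤ : ∀ {m n} → m * m ≤ n * n → m ≤ n
square-reflects-≤ {m} {n} m²≤n² = ≮⇒≥ λ n<m → <⇒≱ (*-mono-< n<m n<m) m²≤n²

mainTheorem10 : ∀ {k l : ℕ} (P : Mat k l) →
    (∃ λ c → ∃ λ N → ∀ (n : ℕ) → N ≤ n → ExAtMost n P (c * n)) →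
    ∃ λ C → ∃ λ M → ∀ (m : ℕ) → M ≤ m →
      ∃ λ b → (b * b ≤ C * m) × SmAtMost m P b
mainTheorem10 {k} {l} P (c , N , ex) = K * K * 4 , N * N , sm-bound
  where
  K : ℕ
  K = c + (k + l)

  sm-bound : ∀ m → N * N ≤ m → ∃ λ b → (b * b ≤ K * K * 4 * m) × SmAtMost m P b
  sm-bound m N²≤m with square-between m
  ... | n , m≤n² , n²≤4m = K * n , Kn²≤ , subst (SmAtMost m P) (sym (*-distribʳ-+ n c (k + l)))
                                                (SmAtMost-square (ex n N≤n) m≤n²)
    where
    N≤n : N ≤ n
    N≤n = square-reflects-≤ (≤-trans N²≤m m≤n²)

    Kn²≤ : K * n * (K * n) ≤ K * K * 4 * m
    Kn²≤ = begin
      K * n * (K * n)   ≡⟨ *-interchange K n K n ⟩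
      K * K * (n * n)   ≤⟨ *-monoʳ-≤ (K * K) n²≤4m ⟩
      K * K * (4 * m)   ≡⟨ *-assoc (K * K) 4 m ⟨
      K * K * 4 * m     ∎
      where open ≤-Reasoning
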